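{- Let $T_1 \oplus T_1' \trianglelefteq S_1$ and $T_2 \oplus T_2' \trianglelefteq S_2$ be degenerations of tensors over a field $\mathbb{F}$, given by maps $(A^{(1)}_\lambda,B^{(1)}_\lambda,C^{(1)}_\lambda)$ and $(A^{(2)}_\lambda,B^{(2)}_\lambda,C^{(2)}_\lambda)$ respectively, such that $T_1'$ is an isolated summand in the third mode with respect to the first degeneration and $T_2'$ is an isolated summand in the third mode with respect to the second. Consider the tensor product degeneration \[ (T_1 \otimes T_2) \oplus (T_1\otimes T_2') \oplus (T_1'\otimes T_2) \oplus (T_1' \otimes T_2') \trianglelefteq S_1 \otimes S_2 \] given by $(A^{(1)}_\lambda\otimes A^{(2)}_\lambda, B^{(1)}_\lambda\otimes B^{(2)}_\lambda, C^{(1)}_\lambda\otimes C^{(2)}_\lambda)$. Then $T_1'\otimes T_2'$ is an isolated summand in the third mode with respect to this degeneration.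
   Context: A degeneration $T\oplus T'\trianglelefteq S$ with $S\in U\otimes V\otimes W$, $T\in U_1'\otimes V_1'\otimes W_1'$, $T'\in U_2'\otimes V_2'\otimes W_2'$ is given by linear maps $A_\lambda:U\to U_1'\oplus U_2'$, $B_\lambda$, $C_\lambda$ (similarly into $V_1'\oplus V_2'$, $W_1'\oplus W_2'$) with entries rational in an indeterminate $\lambda$, such that $R_\lambda=(A_\lambda\otimes B_\lambda\otimes C_\lambda)S$ equals $T\oplus T'+O(\lambda)$ in the Laurent expansion. Write $(R_\lambda)_{ijk}$ for the component of $R_\lambda$ in $U_i'\otimes V_j'\otimes W_k'$. The summand $T'$ is isolated in the third mode with respect to this degeneration if $(R_\lambda)_{ij2}$ is identically zero for all $(i,j)\neq(2,2)$. In the tensor product degeneration, the target spaces $(U^{(1)\prime}_1\oplus U^{(1)\prime}_2)\otimes(U^{(2)\prime}_1\oplus U^{(2)\prime}_2)$ etc. are decomposed into the four corresponding tensor product blocks, and the summand $T_1'\otimes T_2'$ occupies the blocks $U^{(1)\prime}_2\otimes U^{(2)\prime}_2$, $V^{(1)\prime}_2\otimes V^{(2)\prime}_2$, $W^{(1)\prime}_2\otimes W^{(2)\prime}_2$; isolation means all components of the product $R_\lambda$ lying in the third-mode block $W^{(1)\prime}_2\otimes W^{(2)\prime}_2$ but not in both first- and second-mode blocks of $T_1'\otimes T_2'$ vanish identically. -}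

module Defs where

open import Level using (Level; _⊔_)
open import Algebra.Bundles using (CommutativeRing)
open import Data.Nat using (ℕ; zero; suc; _<_)
import Data.Nat as ℕ
open import Data.Fin using (Fin; splitAt; remQuot)
import Data.Fin as F
open import Data.List using (List; []; _∷_)
open import Data.Product using (_×_; _,_; proj₁; proj₂; Σ)
open import Data.Sum using (_⊎_; inj₁; inj₂)
open import Relation.Nullary using (¬_)

record Field (c ℓ : Level) : Set (Level.suc (c ⊔ ℓ)) where
  field
    commutativeRing : CommutativeRing c ℓ
  open CommutativeRing commutativeRing public
  field
    0≉1     : ¬ (0# ≈ 1#)
    inverse : ∀ x → ¬ (x ≈ 0#) → Σ Carrier (λ y → (x * y) ≈ 1#)

module Degen {c ℓ : Level} (𝔽 : Field c ℓ) where
  open Field 𝔽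

  -- Polynomials in the indeterminate λ over 𝔽: coefficient lists,
  -- lowest degree first.
  Poly : Set c
  Poly = List Carrier

  coeff : Poly → ℕ → Carrier
  coeff []       _       = 0#
  coeff (a ∷ p)  zero    = a
  coeff (a ∷ p)  (suc i) = coeff p i

  _+P_ : Poly → Poly → Poly
  []      +P q       = q
  (a ∷ p) +P []      = a ∷ p
  (a ∷ p) +P (b ∷ q) = (a + b) ∷ (p +P q)

  scaleP : Carrier → Poly → Poly
  scaleP c []      = []
  scaleP c (a ∷ p) = (c * a) ∷ scaleP c p

  -P_ : Poly → Poly
  -P p = scaleP (- 1#) p

  _*P_ : Poly → Poly → Poly
  []      *P q = []
  (a ∷ p) *P q = scaleP a q +P (0# ∷ (p *P q))

  IsZeroP : Poly → Set ℓ
  IsZeroP p = ∀ i → coeff p i ≈ 0#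

  DivPow : ℕ → Poly → Set ℓ
  DivPow n p = ∀ i → i < n → coeff p i ≈ 0#

  -- Rational functions in λ: formal fractions num / den.
  record RatFn : Set c where
    constructor _/_
    field
      num : Poly
      den : Poly
  open RatFn public

  ValidR : RatFn → Set ℓ
  ValidR f = ¬ IsZeroP (den f)

  IdZero : RatFn → Set ℓ
  IdZero f = IsZeroP (num f)

  _+R_ : RatFn → RatFn → RatFn
  (p / q) +R (r / s) = ((p *P s) +P (r *P q)) / (q *P s)

  _*R_ : RatFn → RatFn → RatFn
  (p / q) *R (r / s) = (p *P r) / (q *P s)

  constR : Carrier → RatFn
  constR a = (a ∷ []) / (1# ∷ [])

  0R : RatFn
  0R = constR 0#

  sumR : (n : ℕ) → (Fin n → RatFn) → RatFn
  sumR zero    f = 0R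
  sumR (suc n) f = f F.zero +R sumR n (λ i → f (F.suc i))

  -- Laurent expansion of f equals t + O(λ):
  -- writing f = p/q with ord_λ(q) = k, this says ord_λ(p - t q) > k.
  LaurentEq : RatFn → Carrier → Set ℓ
  LaurentEq (p / q) t = ∀ n → DivPow n q → DivPow (suc n) (p +P (-P (scaleP t q)))

  Tensor : ℕ → ℕ → ℕ → Set c
  Tensor u v w = Fin u → Fin v → Fin w → Carrier

  Mat : ℕ → ℕ → Set c
  Mat m n = Fin m → Fin n → RatFn

  ValidMat : ∀ {m n} → Mat m n → Set ℓ
  ValidMat {m} {n} A = ∀ i j → ValidR (A i j)

  apply : ∀ {u v w u' v' w'} → Mat u' u → Mat v' v → Mat w' w →
          Tensor u v w → Fin u' → Fin v' → Fin w' → RatFn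
  apply {u} {v} {w} A B C S i j k =
    sumR u λ x → sumR v λ y → sumR w λ z →
      ((A i x *R B j y) *R C k z) *R constR (S x y z)

  -- direct sum T ⊕ T' ∈ (U₁'⊕U₂') ⊗ (V₁'⊕V₂') ⊗ (W₁'⊕W₂'),
  -- with U₁'⊕U₂' = 𝔽^(a₁+a₂) split by splitAt (first a₁ coordinates = U₁')
  dsum : ∀ {a₁ b₁ c₁ a₂ b₂ c₂} → Tensor a₁ b₁ c₁ → Tensor a₂ b₂ c₂ →
         Tensor (a₁ ℕ.+ a₂) (b₁ ℕ.+ b₂) (c₁ ℕ.+ c₂)
  dsum {a₁} {b₁} {c₁} T T' i j k with splitAt a₁ i | splitAt b₁ j | splitAt c₁ k
  ... | inj₁ i' | inj₁ j' | inj₁ k' = T i' j' k'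
  ... | inj₂ i' | inj₂ j' | inj₂ k' = T' i' j' k'
  ... | _       | _       | _       = 0#

  Degeneration : ∀ {u v w a₁ b₁ c₁ a₂ b₂ c₂} →
    Tensor u v w → Tensor a₁ b₁ c₁ → Tensor a₂ b₂ c₂ →
    Mat (a₁ ℕ.+ a₂) u → Mat (b₁ ℕ.+ b₂) v → Mat (c₁ ℕ.+ c₂) w → Set ℓ
  Degeneration S T T' A B C =
    ValidMat A × ValidMat B × ValidMat C ×
    (∀ i j k → LaurentEq (apply A B C S i j k) (dsum T T' i j k))

  InSnd : ∀ a₁ {a₂} → Fin (a₁ ℕ.+ a₂) → Set
  InSnd a₁ i with splitAt a₁ i
  ... | inj₁ _ = Data.Empty.⊥ where import Data.Empty
  ... | inj₂ _ = Data.Unit.⊤ where import Data.Unit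

  Isolated3 : ∀ {u v w a₁ b₁ c₁ a₂ b₂ c₂} →
    Tensor u v w → Mat (a₁ ℕ.+ a₂) u → Mat (b₁ ℕ.+ b₂) v → Mat (c₁ ℕ.+ c₂) w → Set ℓ
  Isolated3 {a₁ = a₁} {b₁} {c₁} S A B C =
    ∀ i j k → InSnd c₁ k → ¬ (InSnd a₁ i × InSnd b₁ j) → IdZero (apply A B C S i j k)

  split⊗ : ∀ m n → Fin (m ℕ.* n) → Fin m × Fin n
  split⊗ m n = remQuot {m} n

  _⊗T_ : ∀ {u₁ v₁ w₁ u₂ v₂ w₂} → Tensor u₁ v₁ w₁ → Tensor u₂ v₂ w₂ →
         Tensor (u₁ ℕ.* u₂) (v₁ ℕ.* v₂) (w₁ ℕ.* w₂)
  _⊗T_ {u₁} {v₁} {w₁} {u₂} {v₂} {w₂} S₁ S₂ x y z =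
    S₁ (proj₁ (split⊗ u₁ u₂ x)) (proj₁ (split⊗ v₁ v₂ y)) (proj₁ (split⊗ w₁ w₂ z)) *
    S₂ (proj₂ (split⊗ u₁ u₂ x)) (proj₂ (split⊗ v₁ v₂ y)) (proj₂ (split⊗ w₁ w₂ z))

  _⊗M_ : ∀ {m₁ n₁ m₂ n₂} → Mat m₁ n₁ → Mat m₂ n₂ → Mat (m₁ ℕ.* m₂) (n₁ ℕ.* n₂)
  _⊗M_ {m₁} {n₁} {m₂} {n₂} A₁ A₂ i x =
    A₁ (proj₁ (split⊗ m₁ m₂ i)) (proj₁ (split⊗ n₁ n₂ x)) *R
    A₂ (proj₂ (split⊗ m₁ m₂ i)) (proj₂ (split⊗ n₁ n₂ x))

  InSndSnd : ∀ a₁ a₂ a₁' a₂' → Fin ((a₁ ℕ.+ a₂) ℕ.* (a₁' ℕ.+ a₂')) → Set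
  InSndSnd a₁ a₂ a₁' a₂' i =
    InSnd a₁ (proj₁ (split⊗ (a₁ ℕ.+ a₂) (a₁' ℕ.+ a₂') i)) × InSnd a₁' (proj₂ (split⊗ (a₁ ℕ.+ a₂) (a₁' ℕ.+ a₂') i))

  Isolated3⊗ : ∀ {u v w} (a₁ a₂ a₁' a₂' b₁ b₂ b₁' b₂' c₁ c₂ c₁' c₂' : ℕ) →
    Tensor u v w →
    Mat ((a₁ ℕ.+ a₂) ℕ.* (a₁' ℕ.+ a₂')) u → Mat ((b₁ ℕ.+ b₂) ℕ.* (b₁' ℕ.+ b₂')) v →
    Mat ((c₁ ℕ.+ c₂) ℕ.* (c₁' ℕ.+ c₂')) w → Set ℓ
  Isolated3⊗ a₁ a₂ a₁' a₂' b₁ b₂ b₁' b₂' c₁ c₂ c₁' c₂' S A B C =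
    ∀ i j k → InSndSnd c₁ c₂ c₁' c₂' k →
      ¬ (InSndSnd a₁ a₂ a₁' a₂' i × InSndSnd b₁ b₂ b₁' b₂' j) →
      IdZero (apply A B C S i j k)

{-# OPTIONS --safe #-}
module Submission where

-- Write i = (i₁, i₂), j = (j₁, j₂), k = (k₁, k₂) for Kronecker indices.  After
-- reindexing the sums, the (i, j, k) entry of the product R_λ is the product of
-- the (i₁, j₁, k₁) entry of R¹_λ and the (i₂, j₂, k₂) entry of R²_λ (if an index
-- range is empty, both sides vanish).  If k₁ and k₂ lie in the second blocks but
-- (i, j) does not lie in the (2, 2) block of the product, then (i₁, j₁) or
-- (i₂, j₂) is not in the (2, 2) block of its factor, so by isolation one of the
-- two entries vanishes.
--
-- RatFn consists of formal fractions, and cancelling common factors would require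
-- polynomials to form an integral domain.  The product formula is therefore only
-- proved up to the relation ⊑ below, which is enough to transport vanishing.

open import Defs
open import Level using (Level; _⊔_)
open import Data.Nat as ℕ using (ℕ; zero; suc; _+_)
import Data.Fin.Properties as FP
open import Data.Fin as F using (Fin)
open import Function using (_∘_)
open import Data.List using ([]; _∷_)
open import Data.Product using (_×_; _,_; proj₁; proj₂)
open import Data.Sum using (_⊎_; inj₁; inj₂)
open import Data.Unit using (tt)
open import Relation.Nullary using (Dec; yes; no; ¬_)
open import Algebra.Bundles using (CommutativeSemiring)
open import Algebra.Structures.Biased using (isCommutativeSemiringˡ)
import Algebra.Properties.CommutativeSemigroup as CommutativeSemigroupProperties
open import Relation.Binary.Bundles using (Setoid)
open import Relation.Binary.Structures using (IsEquivalence)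
import Relation.Binary.Reasoning.Setoid as SetoidReasoning
import Algebra.Solver.Ring.NaturalCoefficients.Default as NaturalCoefficients
open import Relation.Binary.PropositionalEquality as ≡ using (_≡_)

module Polynomial {c ℓ : Level} (𝔽 : Field c ℓ) where
  open Degen 𝔽
  open Field 𝔽 hiding (zero) renaming (_+_ to _⊕_)
  open CommutativeSemigroupProperties +-commutativeSemigroup using (interchange)
  private module ≈-Reasoning = SetoidReasoning setoid

  infix 4 _≋_
  record _≋_ (p q : Poly) : Set ℓ where
    constructor mk≋
    field coeff-≈ : ∀ i → coeff p i ≈ coeff q i
  open _≋_ public

  ≋-refl : ∀ {p} → p ≋ p
  ≋-refl = mk≋ λ _ → refl

  ≋-sym : ∀ {p q} → p ≋ q → q ≋ p
  ≋-sym e = mk≋ λ i → sym (coeff-≈ e i)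

  ≋-trans : ∀ {p q r} → p ≋ q → q ≋ r → p ≋ r
  ≋-trans e f = mk≋ λ i → trans (coeff-≈ e i) (coeff-≈ f i)

  ≋-isEquivalence : IsEquivalence _≋_
  ≋-isEquivalence = record { refl = ≋-refl ; sym = ≋-sym ; trans = ≋-trans }

  ≋-setoid : Setoid c ℓ
  ≋-setoid = record { isEquivalence = ≋-isEquivalence }

  module ≋-Reasoning = SetoidReasoning ≋-setoid

  shift : Poly → Poly
  shift p = 0# ∷ p

  constP : Carrier → Poly
  constP a = a ∷ []

  1P : Poly
  1P = constP 1#

  coeff-+P : ∀ p q i → coeff (p +P q) i ≈ coeff p i ⊕ coeff q i
  coeff-+P []      q       i       = sym (+-identityˡ _)
  coeff-+P (a ∷ p) []      i       = sym (+-identityʳ _)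
  coeff-+P (a ∷ p) (b ∷ q) zero    = refl
  coeff-+P (a ∷ p) (b ∷ q) (suc i) = coeff-+P p q i

  coeff-scaleP : ∀ x p i → coeff (scaleP x p) i ≈ x * coeff p i
  coeff-scaleP x []      i       = sym (zeroʳ x)
  coeff-scaleP x (a ∷ p) zero    = refl
  coeff-scaleP x (a ∷ p) (suc i) = coeff-scaleP x p i

  +P-cong : ∀ {p p′ q q′} → p ≋ p′ → q ≋ q′ → (p +P q) ≋ (p′ +P q′)
  +P-cong {p} {p′} {q} {q′} e f = mk≋ λ i → begin
    coeff (p +P q) i          ≈⟨ coeff-+P p q i ⟩
    coeff p i ⊕ coeff q i     ≈⟨ +-cong (coeff-≈ e i) (coeff-≈ f i) ⟩
    coeff p′ i ⊕ coeff q′ i   ≈⟨ coeff-+P p′ q′ i ⟨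
    coeff (p′ +P q′) i        ∎
    where open ≈-Reasoning

  +P-comm : ∀ p q → (p +P q) ≋ (q +P p)
  +P-comm p q = mk≋ λ i → begin
    coeff (p +P q) i        ≈⟨ coeff-+P p q i ⟩
    coeff p i ⊕ coeff q i   ≈⟨ +-comm _ _ ⟩
    coeff q i ⊕ coeff p i   ≈⟨ coeff-+P q p i ⟨
    coeff (q +P p) i        ∎
    where open ≈-Reasoning

  +P-assoc : ∀ p q r → ((p +P q) +P r) ≋ (p +P (q +P r))
  +P-assoc p q r = mk≋ λ i → begin
    coeff ((p +P q) +P r) i                ≈⟨ coeff-+P (p +P q) r i ⟩
    coeff (p +P q) i ⊕ coeff r i           ≈⟨ +-congʳ (coeff-+P p q i) ⟩
    (coeff p i ⊕ coeff q i) ⊕ coeff r i    ≈⟨ +-assoc _ _ _ ⟩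
    coeff p i ⊕ (coeff q i ⊕ coeff r i)    ≈⟨ +-congˡ (coeff-+P q r i) ⟨
    coeff p i ⊕ coeff (q +P r) i           ≈⟨ coeff-+P p (q +P r) i ⟨
    coeff (p +P (q +P r)) i                ∎
    where open ≈-Reasoning

  +P-identityʳ : ∀ p → (p +P []) ≋ p
  +P-identityʳ p = mk≋ λ i → trans (coeff-+P p [] i) (+-identityʳ _)

  +P-interchange : ∀ p q r s → ((p +P q) +P (r +P s)) ≋ ((p +P r) +P (q +P s))
  +P-interchange p q r s = mk≋ λ i → begin
    coeff ((p +P q) +P (r +P s)) i                        ≈⟨ coeff-+P-+P p q r s i ⟩
    (coeff p i ⊕ coeff q i) ⊕ (coeff r i ⊕ coeff s i)     ≈⟨ interchange _ _ _ _ ⟩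
    (coeff p i ⊕ coeff r i) ⊕ (coeff q i ⊕ coeff s i)     ≈⟨ coeff-+P-+P p r q s i ⟨
    coeff ((p +P r) +P (q +P s)) i                        ∎
    where
    open ≈-Reasoning
    coeff-+P-+P : ∀ p q r s i →
      coeff ((p +P q) +P (r +P s)) i ≈ (coeff p i ⊕ coeff q i) ⊕ (coeff r i ⊕ coeff s i)
    coeff-+P-+P p q r s i =
      trans (coeff-+P (p +P q) (r +P s) i) (+-cong (coeff-+P p q i) (coeff-+P r s i))

  scaleP-congˡ : ∀ x {p q} → p ≋ q → scaleP x p ≋ scaleP x q
  scaleP-congˡ x {p} {q} e = mk≋ λ i → begin
    coeff (scaleP x p) i   ≈⟨ coeff-scaleP x p i ⟩
    x * coeff p i          ≈⟨ *-congˡ (coeff-≈ e i) ⟩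
    x * coeff q i          ≈⟨ coeff-scaleP x q i ⟨
    coeff (scaleP x q) i   ∎
    where open ≈-Reasoning

  scaleP-distribˡ : ∀ x p q → scaleP x (p +P q) ≋ (scaleP x p +P scaleP x q)
  scaleP-distribˡ x p q = mk≋ λ i → begin
    coeff (scaleP x (p +P q)) i                    ≈⟨ coeff-scaleP x (p +P q) i ⟩
    x * coeff (p +P q) i                           ≈⟨ *-congˡ (coeff-+P p q i) ⟩
    x * (coeff p i ⊕ coeff q i)                    ≈⟨ distribˡ _ _ _ ⟩
    x * coeff p i ⊕ x * coeff q i                  ≈⟨ +-cong (coeff-scaleP x p i) (coeff-scaleP x q i) ⟨
    coeff (scaleP x p) i ⊕ coeff (scaleP x q) i    ≈⟨ coeff-+P (scaleP x p) (scaleP x q) i ⟨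
    coeff (scaleP x p +P scaleP x q) i             ∎
    where open ≈-Reasoning

  scaleP-distribʳ : ∀ x y p → scaleP (x ⊕ y) p ≋ (scaleP x p +P scaleP y p)
  scaleP-distribʳ x y p = mk≋ λ i → begin
    coeff (scaleP (x ⊕ y) p) i                     ≈⟨ coeff-scaleP (x ⊕ y) p i ⟩
    (x ⊕ y) * coeff p i                            ≈⟨ distribʳ _ _ _ ⟩
    x * coeff p i ⊕ y * coeff p i                  ≈⟨ +-cong (coeff-scaleP x p i) (coeff-scaleP y p i) ⟨
    coeff (scaleP x p) i ⊕ coeff (scaleP y p) i    ≈⟨ coeff-+P (scaleP x p) (scaleP y p) i ⟨
    coeff (scaleP x p +P scaleP y p) i             ∎
    where open ≈-Reasoning

  scaleP-assoc : ∀ x y p → scaleP (x * y) p ≋ scaleP x (scaleP y p)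
  scaleP-assoc x y p = mk≋ λ i → begin
    coeff (scaleP (x * y) p) i          ≈⟨ coeff-scaleP (x * y) p i ⟩
    (x * y) * coeff p i                 ≈⟨ *-assoc _ _ _ ⟩
    x * (y * coeff p i)                 ≈⟨ *-congˡ (coeff-scaleP y p i) ⟨
    x * coeff (scaleP y p) i            ≈⟨ coeff-scaleP x (scaleP y p) i ⟨
    coeff (scaleP x (scaleP y p)) i     ∎
    where open ≈-Reasoning

  scaleP-zeroˡ : ∀ p → scaleP 0# p ≋ []
  scaleP-zeroˡ p = mk≋ λ i → trans (coeff-scaleP 0# p i) (zeroˡ _)

  scaleP-identityˡ : ∀ p → scaleP 1# p ≋ p
  scaleP-identityˡ p = mk≋ λ i → trans (coeff-scaleP 1# p i) (*-identityˡ _)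

  shift-cong : ∀ {p q} → p ≋ q → shift p ≋ shift q
  shift-cong e = mk≋ λ { zero → refl ; (suc i) → coeff-≈ e i }

  shift-+P : ∀ p q → shift (p +P q) ≋ (shift p +P shift q)
  shift-+P p q = mk≋ λ { zero → sym (+-identityʳ _) ; (suc i) → refl }

  scaleP-shift : ∀ x p → scaleP x (shift p) ≋ shift (scaleP x p)
  scaleP-shift x p = mk≋ λ { zero → zeroʳ x ; (suc i) → refl }

  shift-[] : shift [] ≋ []
  shift-[] = mk≋ λ { zero → refl ; (suc i) → refl }

  constP-* : ∀ a b → constP (a * b) ≋ (constP a *P constP b)
  constP-* a b = mk≋ λ { zero → sym (+-identityʳ _) ; (suc i) → refl }

  *P-congˡ : ∀ p {q q′} → q ≋ q′ → (p *P q) ≋ (p *P q′)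
  *P-congˡ []      e = ≋-refl
  *P-congˡ (a ∷ p) e = +P-cong (scaleP-congˡ a e) (shift-cong (*P-congˡ p e))

  *P-zeroʳ : ∀ p → (p *P []) ≋ []
  *P-zeroʳ []      = ≋-refl
  *P-zeroʳ (a ∷ p) = mk≋ λ { zero → refl ; (suc i) → coeff-≈ (*P-zeroʳ p) i }

  *P-shiftʳ : ∀ p q → (p *P shift q) ≋ shift (p *P q)
  *P-shiftʳ []      q = ≋-sym shift-[]
  *P-shiftʳ (a ∷ p) q = mk≋ λ
    { zero    → trans (+-identityʳ _) (zeroʳ a)
    ; (suc i) → coeff-≈ (+P-cong {scaleP a q} ≋-refl (*P-shiftʳ p q)) i }

  *P-constʳ : ∀ p a → (p *P constP a) ≋ scaleP a p
  *P-constʳ []      a = ≋-refl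
  *P-constʳ (b ∷ p) a = mk≋ λ
    { zero    → trans (+-identityʳ _) (*-comm b a)
    ; (suc i) → coeff-≈ (*P-constʳ p a) i }

  *P-distribˡ : ∀ p q r → p *P (q +P r) ≋ (p *P q) +P (p *P r)
  *P-distribˡ []      q r = ≋-refl
  *P-distribˡ (a ∷ p) q r =
    ≋-trans (+P-cong (scaleP-distribˡ a q r)
                     (≋-trans (shift-cong (*P-distribˡ p q r)) (shift-+P (p *P q) (p *P r))))
            (+P-interchange (scaleP a q) (scaleP a r) (shift (p *P q)) (shift (p *P r)))

  *P-distribʳ : ∀ r p q → (p +P q) *P r ≋ (p *P r) +P (q *P r)
  *P-distribʳ r []      q       = ≋-refl
  *P-distribʳ r (a ∷ p) []      = ≋-sym (+P-identityʳ _)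
  *P-distribʳ r (a ∷ p) (b ∷ q) =
    ≋-trans (+P-cong (scaleP-distribʳ a b r)
                     (≋-trans (shift-cong (*P-distribʳ r p q)) (shift-+P (p *P r) (q *P r))))
            (+P-interchange (scaleP a r) (scaleP b r) (shift (p *P r)) (shift (q *P r)))

  *P-comm : ∀ p q → (p *P q) ≋ (q *P p)
  *P-comm []      q = ≋-sym (*P-zeroʳ q)
  *P-comm (a ∷ p) q = begin
    scaleP a q +P shift (p *P q)         ≈⟨ +P-cong (*P-constʳ q a) (shift-cong (*P-comm q p)) ⟨
    (q *P constP a) +P shift (q *P p)    ≈⟨ +P-cong ≋-refl (*P-shiftʳ q p) ⟨
    (q *P constP a) +P (q *P shift p)    ≈⟨ *P-distribˡ q (constP a) (shift p) ⟨
    q *P ((a ⊕ 0#) ∷ p)                  ≈⟨ *P-congˡ q (mk≋ λ { zero → +-identityʳ a ; (suc i) → refl }) ⟩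
    q *P (a ∷ p)                         ∎
    where open ≋-Reasoning

  *P-congʳ : ∀ {p p′} q → p ≋ p′ → (p *P q) ≋ (p′ *P q)
  *P-congʳ {p} {p′} q e = ≋-trans (*P-comm p q) (≋-trans (*P-congˡ q e) (*P-comm q p′))

  *P-cong : ∀ {p p′ q q′} → p ≋ p′ → q ≋ q′ → (p *P q) ≋ (p′ *P q′)
  *P-cong {p} {p′} {q} e f = ≋-trans (*P-congʳ q e) (*P-congˡ p′ f)

  scaleP-*P : ∀ x p q → (scaleP x p *P q) ≋ scaleP x (p *P q)
  scaleP-*P x []      q = ≋-refl
  scaleP-*P x (a ∷ p) q = begin
    scaleP (x * a) q +P shift (scaleP x p *P q)          ≈⟨ +P-cong (scaleP-assoc x a q) (shift-cong (scaleP-*P x p q)) ⟩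
    scaleP x (scaleP a q) +P shift (scaleP x (p *P q))   ≈⟨ +P-cong ≋-refl (scaleP-shift x (p *P q)) ⟨
    scaleP x (scaleP a q) +P scaleP x (shift (p *P q))   ≈⟨ scaleP-distribˡ x (scaleP a q) (shift (p *P q)) ⟨
    scaleP x (scaleP a q +P shift (p *P q))              ∎
    where open ≋-Reasoning

  *P-assoc : ∀ p q r → ((p *P q) *P r) ≋ (p *P (q *P r))
  *P-assoc []      q r = ≋-refl
  *P-assoc (a ∷ p) q r = begin
    (scaleP a q +P shift (p *P q)) *P r           ≈⟨ *P-distribʳ r (scaleP a q) (shift (p *P q)) ⟩
    (scaleP a q *P r) +P (shift (p *P q) *P r)    ≈⟨ +P-cong (scaleP-*P a q r) (+P-cong (scaleP-zeroˡ r) ≋-refl) ⟩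
    scaleP a (q *P r) +P shift ((p *P q) *P r)    ≈⟨ +P-cong ≋-refl (shift-cong (*P-assoc p q r)) ⟩
    scaleP a (q *P r) +P shift (p *P (q *P r))    ∎
    where open ≋-Reasoning

  *P-identityˡ : ∀ p → (1P *P p) ≋ p
  *P-identityˡ p = ≋-trans (+P-cong (scaleP-identityˡ p) shift-[]) (+P-identityʳ p)

  *P-identityʳ : ∀ p → (p *P 1P) ≋ p
  *P-identityʳ p = ≋-trans (*P-comm p 1P) (*P-identityˡ p)

  +P-*P-commutativeSemiring : CommutativeSemiring c ℓ
  +P-*P-commutativeSemiring = record
    { isCommutativeSemiring = isCommutativeSemiringˡ record
      { +-isCommutativeMonoid = record
        { isMonoid = record
          { isSemigroup = record
            { isMagma = record { isEquivalence = ≋-isEquivalence ; ∙-cong = +P-cong }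
            ; assoc = +P-assoc }
          ; identity = (λ _ → ≋-refl) , +P-identityʳ }
        ; comm = +P-comm }
      ; *-isCommutativeMonoid = record
        { isMonoid = record
          { isSemigroup = record
            { isMagma = record { isEquivalence = ≋-isEquivalence ; ∙-cong = *P-cong }
            ; assoc = *P-assoc }
          ; identity = *P-identityˡ , *P-identityʳ }
        ; comm = *P-comm }
      ; distribʳ = *P-distribʳ
      ; zeroˡ = λ _ → ≋-refl } }

module RationalFunction {c ℓ : Level} (𝔽 : Field c ℓ) where
  open Degen 𝔽
  open Polynomial 𝔽
  open NaturalCoefficients +P-*P-commutativeSemiring using (solve; _:=_; _:+_; _:*_)
  open CommutativeSemigroupProperties (CommutativeSemiring.*-commutativeSemigroup +P-*P-commutativeSemiring)
    using () renaming (interchange to *P-interchange)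

  infix 4 _≃_ _⊑_

  record _≃_ (f g : RatFn) : Set ℓ where
    constructor mk≃
    field
      num-≋ : num f ≋ num g
      den-≋ : den f ≋ den g

  ≃-sym : ∀ {f g} → f ≃ g → g ≃ f
  ≃-sym (mk≃ n d) = mk≃ (≋-sym n) (≋-sym d)

  record _⊑_ (f g : RatFn) : Set (c ⊔ ℓ) where
    constructor mk⊑
    field
      factor : Poly
      num-≋  : num f ≋ (factor *P num g)
      den-≋  : den f ≋ (factor *P den g)

  ≃⇒⊑ : ∀ {f g} → f ≃ g → f ⊑ g
  ≃⇒⊑ (mk≃ n d) = mk⊑ 1P (≋-trans n (≋-sym (*P-identityˡ _))) (≋-trans d (≋-sym (*P-identityˡ _)))

  ⊑-refl : ∀ {f} → f ⊑ f
  ⊑-refl = ≃⇒⊑ (mk≃ ≋-refl ≋-refl)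

  ⊑-reflexive : ∀ {f g} → f ≡ g → f ⊑ g
  ⊑-reflexive ≡.refl = ⊑-refl

  ⊑-trans : ∀ {f g h} → f ⊑ g → g ⊑ h → f ⊑ h
  ⊑-trans (mk⊑ M n d) (mk⊑ K n′ d′) = mk⊑ (M *P K)
    (≋-trans n (≋-trans (*P-congˡ M n′) (≋-sym (*P-assoc M K _))))
    (≋-trans d (≋-trans (*P-congˡ M d′) (≋-sym (*P-assoc M K _))))

  +R-cong : ∀ {f f′ g g′} → f ⊑ g → f′ ⊑ g′ → (f +R f′) ⊑ (g +R g′)
  +R-cong {g = g} {g′} (mk⊑ M n d) (mk⊑ M′ n′ d′) = mk⊑ (M *P M′)
    (≋-trans (+P-cong (*P-cong n d′) (*P-cong n′ d))
      (solve 6 (λ M M′ ng dg ng′ dg′ →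
                   ((M :* ng) :* (M′ :* dg′)) :+ ((M′ :* ng′) :* (M :* dg))
                := (M :* M′) :* ((ng :* dg′) :+ (ng′ :* dg))) ≋-refl
         M M′ (num g) (den g) (num g′) (den g′)))
    (≋-trans (*P-cong d d′) (*P-interchange M (den g) M′ (den g′)))

  *R-cong : ∀ {f f′ g g′} → f ⊑ g → f′ ⊑ g′ → (f *R f′) ⊑ (g *R g′)
  *R-cong {g = g} {g′} (mk⊑ M n d) (mk⊑ M′ n′ d′) = mk⊑ (M *P M′)
    (≋-trans (*P-cong n n′) (*P-interchange M (num g) M′ (num g′)))
    (≋-trans (*P-cong d d′) (*P-interchange M (den g) M′ (den g′)))

  +R-congˡ : ∀ f {g g′} → g ⊑ g′ → (f +R g) ⊑ (f +R g′)
  +R-congˡ f = +R-cong (⊑-refl {f})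

  *R-congˡ : ∀ f {g g′} → g ⊑ g′ → (f *R g) ⊑ (f *R g′)
  *R-congˡ f = *R-cong (⊑-refl {f})

  *R-congʳ : ∀ g {f f′} → f ⊑ f′ → (f *R g) ⊑ (f′ *R g)
  *R-congʳ g f⊑f′ = *R-cong f⊑f′ (⊑-refl {g})

  +R-identityˡ : ∀ f → (0R +R f) ≃ f
  +R-identityˡ f = mk≃
    (≋-trans (+P-cong (*P-congʳ (den f) shift-[]) ≋-refl) (*P-identityʳ (num f)))
    (*P-identityˡ (den f))

  +R-identityʳ : ∀ f → (f +R 0R) ≃ f
  +R-identityʳ f = mk≃
    (≋-trans (+P-cong (*P-identityʳ (num f)) (*P-congʳ (den f) shift-[])) (+P-identityʳ (num f)))
    (*P-identityʳ (den f))

  +R-assoc : ∀ f g h → ((f +R g) +R h) ≃ (f +R (g +R h))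
  +R-assoc f g h = mk≃
    (solve 6 (λ nf df ng dg nh dh →
                 ((nf :* dg) :+ (ng :* df)) :* dh :+ nh :* (df :* dg)
              := nf :* (dg :* dh) :+ ((ng :* dh) :+ (nh :* dg)) :* df) ≋-refl
       (num f) (den f) (num g) (den g) (num h) (den h))
    (*P-assoc (den f) (den g) (den h))

  +R-interchange : ∀ f g h k → ((f +R g) +R (h +R k)) ≃ ((f +R h) +R (g +R k))
  +R-interchange f g h k = mk≃
    (solve 8 (λ nf df ng dg nh dh nk dk →
                 ((nf :* dg) :+ (ng :* df)) :* (dh :* dk) :+ ((nh :* dk) :+ (nk :* dh)) :* (df :* dg)
              := ((nf :* dh) :+ (nh :* df)) :* (dg :* dk) :+ ((ng :* dk) :+ (nk :* dg)) :* (df :* dh)) ≋-refl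
       (num f) (den f) (num g) (den g) (num h) (den h) (num k) (den k))
    (*P-interchange (den f) (den g) (den h) (den k))

  *R-distribˡ : ∀ f g h → ((f *R g) +R (f *R h)) ⊑ (f *R (g +R h))
  *R-distribˡ f g h = mk⊑ (den f)
    (solve 6 (λ nf df ng dg nh dh →
                 (nf :* ng) :* (df :* dh) :+ (nf :* nh) :* (df :* dg)
              := df :* (nf :* ((ng :* dh) :+ (nh :* dg)))) ≋-refl
       (num f) (den f) (num g) (den g) (num h) (den h))
    (solve 3 (λ df dg dh → (df :* dg) :* (df :* dh) := df :* (df :* (dg :* dh))) ≋-refl
       (den f) (den g) (den h))

  *R-distribʳ : ∀ h f g → ((f *R h) +R (g *R h)) ⊑ ((f +R g) *R h)
  *R-distribʳ h f g = mk⊑ (den h)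
    (solve 6 (λ nf df ng dg nh dh →
                 (nf :* nh) :* (dg :* dh) :+ (ng :* nh) :* (df :* dh)
              := dh :* (((nf :* dg) :+ (ng :* df)) :* nh)) ≋-refl
       (num f) (den f) (num g) (den g) (num h) (den h))
    (solve 3 (λ df dg dh → (df :* dh) :* (dg :* dh) := dh :* ((df :* dg) :* dh)) ≋-refl
       (den f) (den g) (den h))

  -- IdZero as a record, so that f can be inferred from IsZeroR f.
  record IsZeroR (f : RatFn) : Set ℓ where
    constructor mkIsZeroR
    field num≋[] : num f ≋ []

  IsZeroR-⊑ : ∀ {f g} → f ⊑ g → IsZeroR g → IsZeroR f
  IsZeroR-⊑ (mk⊑ M n _) (mkIsZeroR z) = mkIsZeroR (≋-trans n (≋-trans (*P-congˡ M z) (*P-zeroʳ M)))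

  IsZeroR-0R : IsZeroR 0R
  IsZeroR-0R = mkIsZeroR shift-[]

  IsZeroR-+R : ∀ {f g} → IsZeroR f → IsZeroR g → IsZeroR (f +R g)
  IsZeroR-+R {f} {g} (mkIsZeroR zf) (mkIsZeroR zg) =
    mkIsZeroR (+P-cong (*P-congʳ (den g) zf) (*P-congʳ (den f) zg))

  IsZeroR-*R : ∀ {f g} → IsZeroR f ⊎ IsZeroR g → IsZeroR (f *R g)
  IsZeroR-*R {g = g} (inj₁ (mkIsZeroR z)) = mkIsZeroR (*P-congʳ (num g) z)
  IsZeroR-*R {f = f} (inj₂ (mkIsZeroR z)) = mkIsZeroR (≋-trans (*P-congˡ (num f) z) (*P-zeroʳ (num f)))

module FiniteSum {c ℓ : Level} (𝔽 : Field c ℓ) where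
  open Degen 𝔽
  open RationalFunction 𝔽

  sumR-cong : ∀ n {f g : Fin n → RatFn} → (∀ a → f a ⊑ g a) → sumR n f ⊑ sumR n g
  sumR-cong zero    e = ⊑-refl
  sumR-cong (suc n) e = +R-cong (e F.zero) (sumR-cong n (e ∘ F.suc))

  IsZeroR-sumR : ∀ n {f : Fin n → RatFn} → (∀ a → IsZeroR (f a)) → IsZeroR (sumR n f)
  IsZeroR-sumR zero    z = IsZeroR-0R
  IsZeroR-sumR (suc n) z = IsZeroR-+R (z F.zero) (IsZeroR-sumR n (z ∘ F.suc))

  sumR-0R : ∀ n → sumR n (λ _ → 0R) ⊑ 0R
  sumR-0R zero    = ⊑-refl
  sumR-0R (suc n) = ⊑-trans (+R-congˡ 0R (sumR-0R n)) (≃⇒⊑ (+R-identityˡ 0R))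

  sumR-+R : ∀ n (f g : Fin n → RatFn) → sumR n (λ a → f a +R g a) ⊑ (sumR n f +R sumR n g)
  sumR-+R zero    f g = ≃⇒⊑ (≃-sym (+R-identityˡ 0R))
  sumR-+R (suc n) f g = ⊑-trans (+R-congˡ (f F.zero +R g F.zero) (sumR-+R n (f ∘ F.suc) (g ∘ F.suc)))
    (≃⇒⊑ (+R-interchange (f F.zero) (g F.zero) (sumR n (f ∘ F.suc)) (sumR n (g ∘ F.suc))))

  sumR-comm : ∀ m n (h : Fin m → Fin n → RatFn) →
    sumR m (λ a → sumR n (h a)) ⊑ sumR n (λ b → sumR m (λ a → h a b))
  sumR-comm m zero    h = sumR-0R m
  sumR-comm m (suc n) h = ⊑-trans (sumR-+R m (λ a → h a F.zero) (λ a → sumR n (h a ∘ F.suc)))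
    (+R-congˡ (sumR m (λ a → h a F.zero)) (sumR-comm m n (λ a → h a ∘ F.suc)))

  sumR-split : ∀ m n (f : Fin (m ℕ.+ n) → RatFn) →
    sumR (m ℕ.+ n) f ⊑ (sumR m (f ∘ (F._↑ˡ n)) +R sumR n (f ∘ (m F.↑ʳ_)))
  sumR-split zero    n f = ≃⇒⊑ (≃-sym (+R-identityˡ (sumR n f)))
  sumR-split (suc m) n f = ⊑-trans (+R-congˡ (f F.zero) (sumR-split m n (f ∘ F.suc)))
    (≃⇒⊑ (≃-sym (+R-assoc (f F.zero) (sumR m (f ∘ F.suc ∘ (F._↑ˡ n)))
                                      (sumR n (f ∘ F.suc ∘ (m F.↑ʳ_))))))

  sumR-remQuot : ∀ m n (h : Fin m × Fin n → RatFn) →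
    sumR (m ℕ.* n) (h ∘ F.remQuot n) ⊑ sumR m (λ a → sumR n (λ b → h (a , b)))
  sumR-remQuot zero    n h = ⊑-refl
  sumR-remQuot (suc m) n h = ⊑-trans (sumR-split n (m ℕ.* n) (h ∘ F.remQuot n))
    (+R-cong (sumR-cong n (λ b → ⊑-reflexive (≡.cong h (FP.remQuot-combine F.zero b))))
             (⊑-trans (sumR-cong (m ℕ.* n) (λ y → ⊑-reflexive (≡.cong h (remQuot-↑ʳ y))))
                      (sumR-remQuot m n (λ (a , b) → h (F.suc a , b)))))
    where
    remQuot-↑ʳ : ∀ y →
      F.remQuot {suc m} n (n F.↑ʳ y) ≡ (F.suc (proj₁ (F.remQuot {m} n y)) , proj₂ (F.remQuot {m} n y))
    remQuot-↑ʳ y rewrite FP.splitAt-↑ʳ n (m ℕ.* n) y = ≡.refl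

  sumR-*R-distribˡ : ∀ n f (g : Fin (suc n) → RatFn) →
    sumR (suc n) (λ b → f *R g b) ⊑ (f *R sumR (suc n) g)
  sumR-*R-distribˡ zero    f g =
    ⊑-trans (≃⇒⊑ (+R-identityʳ (f *R g F.zero))) (*R-congˡ f (≃⇒⊑ (≃-sym (+R-identityʳ (g F.zero)))))
  sumR-*R-distribˡ (suc n) f g = ⊑-trans (+R-congˡ (f *R g F.zero) (sumR-*R-distribˡ n f (g ∘ F.suc)))
    (*R-distribˡ f (g F.zero) (sumR (suc n) (g ∘ F.suc)))

  sumR-*R-distribʳ : ∀ n (f : Fin (suc n) → RatFn) g →
    sumR (suc n) (λ a → f a *R g) ⊑ (sumR (suc n) f *R g)
  sumR-*R-distribʳ zero    f g =
    ⊑-trans (≃⇒⊑ (+R-identityʳ (f F.zero *R g))) (*R-congʳ g (≃⇒⊑ (≃-sym (+R-identityʳ (f F.zero)))))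
  sumR-*R-distribʳ (suc n) f g = ⊑-trans (+R-congˡ (f F.zero *R g) (sumR-*R-distribʳ n (f ∘ F.suc) g))
    (*R-distribʳ g (f F.zero) (sumR (suc n) (f ∘ F.suc)))

  sumR³ : ∀ u v w → (Fin u → Fin v → Fin w → RatFn) → RatFn
  sumR³ u v w h = sumR u λ x → sumR v λ y → sumR w λ z → h x y z

  sumR³-cong : ∀ u v w {f g : Fin u → Fin v → Fin w → RatFn} →
    (∀ x y z → f x y z ⊑ g x y z) → sumR³ u v w f ⊑ sumR³ u v w g
  sumR³-cong u v w e = sumR-cong u λ x → sumR-cong v λ y → sumR-cong w λ z → e x y z

  IsZeroR-sumR³ : ∀ u v w {h : Fin u → Fin v → Fin w → RatFn} →
    (∀ x y z → IsZeroR (h x y z)) → IsZeroR (sumR³ u v w h)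
  IsZeroR-sumR³ u v w z = IsZeroR-sumR u λ x → IsZeroR-sumR v λ y → IsZeroR-sumR w λ z′ → z x y z′

  sumR³-remQuot : ∀ u₁ v₁ w₁ u₂ v₂ w₂
    (h : Fin u₁ × Fin u₂ → Fin v₁ × Fin v₂ → Fin w₁ × Fin w₂ → RatFn) →
    sumR³ (u₁ ℕ.* u₂) (v₁ ℕ.* v₂) (w₁ ℕ.* w₂)
      (λ x y z → h (F.remQuot u₂ x) (F.remQuot v₂ y) (F.remQuot w₂ z))
      ⊑ sumR³ u₁ v₁ w₁ (λ x₁ y₁ z₁ → sumR³ u₂ v₂ w₂ λ x₂ y₂ z₂ → h (x₁ , x₂) (y₁ , y₂) (z₁ , z₂))
  -- Reindexing gives the summation order x₁ x₂ y₁ y₂ z₁ z₂; three swaps turn it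
  -- into x₁ y₁ z₁ x₂ y₂ z₂.
  sumR³-remQuot u₁ v₁ w₁ u₂ v₂ w₂ h =
    ⊑-trans (sumR-cong (u₁ ℕ.* u₂) λ x → sumR-cong (v₁ ℕ.* v₂) λ y →
               sumR-remQuot w₁ w₂ (h (F.remQuot u₂ x) (F.remQuot v₂ y)))
    (⊑-trans (sumR-cong (u₁ ℕ.* u₂) λ x →
               sumR-remQuot v₁ v₂ λ y → sumR w₁ λ z₁ → sumR w₂ λ z₂ → h (F.remQuot u₂ x) y (z₁ , z₂))
    (⊑-trans (sumR-remQuot u₁ u₂ λ x → sumR v₁ λ y₁ → sumR v₂ λ y₂ → sumR w₁ λ z₁ → sumR w₂ λ z₂ →
               h x (y₁ , y₂) (z₁ , z₂))
    (⊑-trans (sumR-cong u₁ λ x₁ → sumR-comm u₂ v₁ λ x₂ y₁ →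
               sumR v₂ λ y₂ → sumR w₁ λ z₁ → sumR w₂ (H x₁ x₂ y₁ y₂ z₁))
    (⊑-trans (sumR-cong u₁ λ x₁ → sumR-cong v₁ λ y₁ → sumR-cong u₂ λ x₂ →
               sumR-comm v₂ w₁ λ y₂ z₁ → sumR w₂ (H x₁ x₂ y₁ y₂ z₁))
             (sumR-cong u₁ λ x₁ → sumR-cong v₁ λ y₁ →
               sumR-comm u₂ w₁ λ x₂ z₁ → sumR v₂ λ y₂ → sumR w₂ (H x₁ x₂ y₁ y₂ z₁))))))
    where
    H : Fin u₁ → Fin u₂ → Fin v₁ → Fin v₂ → Fin w₁ → Fin w₂ → RatFn
    H x₁ x₂ y₁ y₂ z₁ z₂ = h (x₁ , x₂) (y₁ , y₂) (z₁ , z₂)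

  sumR³-*R-distribˡ : ∀ u v w f (g : Fin (suc u) → Fin (suc v) → Fin (suc w) → RatFn) →
    sumR³ (suc u) (suc v) (suc w) (λ x y z → f *R g x y z) ⊑ (f *R sumR³ (suc u) (suc v) (suc w) g)
  sumR³-*R-distribˡ u v w f g =
    ⊑-trans (sumR-cong (suc u) λ x → sumR-cong (suc v) λ y → sumR-*R-distribˡ w f (g x y))
    (⊑-trans (sumR-cong (suc u) λ x → sumR-*R-distribˡ v f (λ y → sumR (suc w) (g x y)))
             (sumR-*R-distribˡ u f (λ x → sumR (suc v) λ y → sumR (suc w) (g x y))))

  sumR³-*R-distribʳ : ∀ u v w (f : Fin (suc u) → Fin (suc v) → Fin (suc w) → RatFn) g →
    sumR³ (suc u) (suc v) (suc w) (λ x y z → f x y z *R g) ⊑ (sumR³ (suc u) (suc v) (suc w) f *R g)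
  sumR³-*R-distribʳ u v w f g =
    ⊑-trans (sumR-cong (suc u) λ x → sumR-cong (suc v) λ y → sumR-*R-distribʳ w (f x y) g)
    (⊑-trans (sumR-cong (suc u) λ x → sumR-*R-distribʳ v (λ y → sumR (suc w) (f x y)) g)
             (sumR-*R-distribʳ u (λ x → sumR (suc v) λ y → sumR (suc w) (f x y)) g))

  sumR³-*R : ∀ {u₁ v₁ w₁ u₂ v₂ w₂}
    (f : Fin (suc u₁) → Fin (suc v₁) → Fin (suc w₁) → RatFn)
    (g : Fin (suc u₂) → Fin (suc v₂) → Fin (suc w₂) → RatFn) →
    sumR³ (suc u₁) (suc v₁) (suc w₁) (λ x₁ y₁ z₁ → sumR³ (suc u₂) (suc v₂) (suc w₂) λ x₂ y₂ z₂ →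
      f x₁ y₁ z₁ *R g x₂ y₂ z₂)
      ⊑ (sumR³ (suc u₁) (suc v₁) (suc w₁) f *R sumR³ (suc u₂) (suc v₂) (suc w₂) g)
  sumR³-*R {u₁} {v₁} {w₁} {u₂} {v₂} {w₂} f g =
    ⊑-trans (sumR³-cong (suc u₁) (suc v₁) (suc w₁) λ x y z → sumR³-*R-distribˡ u₂ v₂ w₂ (f x y z) g)
            (sumR³-*R-distribʳ u₁ v₁ w₁ f (sumR³ (suc u₂) (suc v₂) (suc w₂) g))

  -- Empty index ranges are treated separately: the empty sum 0R = 0 / 1 is not
  -- ⊑ f *R 0R, whose denominator is den f * 1.
  IsZeroR-sumR³-*R : ∀ {u₁ v₁ w₁ u₂ v₂ w₂}
    (f : Fin u₁ → Fin v₁ → Fin w₁ → RatFn) (g : Fin u₂ → Fin v₂ → Fin w₂ → RatFn) →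
    IsZeroR (sumR³ u₁ v₁ w₁ f) ⊎ IsZeroR (sumR³ u₂ v₂ w₂ g) →
    IsZeroR (sumR³ u₁ v₁ w₁ λ x₁ y₁ z₁ → sumR³ u₂ v₂ w₂ λ x₂ y₂ z₂ → f x₁ y₁ z₁ *R g x₂ y₂ z₂)
  IsZeroR-sumR³-*R {zero} f g _ = IsZeroR-0R
  IsZeroR-sumR³-*R {suc u₁} {zero} f g _ = IsZeroR-sumR (suc u₁) λ _ → IsZeroR-0R
  IsZeroR-sumR³-*R {suc u₁} {suc v₁} {zero} f g _ =
    IsZeroR-sumR (suc u₁) λ _ → IsZeroR-sumR (suc v₁) λ _ → IsZeroR-0R
  IsZeroR-sumR³-*R {suc u₁} {suc v₁} {suc w₁} {zero} f g _ =
    IsZeroR-sumR³ (suc u₁) (suc v₁) (suc w₁) λ _ _ _ → IsZeroR-0R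
  IsZeroR-sumR³-*R {suc u₁} {suc v₁} {suc w₁} {suc u₂} {zero} f g _ =
    IsZeroR-sumR³ (suc u₁) (suc v₁) (suc w₁) λ _ _ _ → IsZeroR-sumR (suc u₂) λ _ → IsZeroR-0R
  IsZeroR-sumR³-*R {suc u₁} {suc v₁} {suc w₁} {suc u₂} {suc v₂} {zero} f g _ =
    IsZeroR-sumR³ (suc u₁) (suc v₁) (suc w₁) λ _ _ _ →
      IsZeroR-sumR (suc u₂) λ _ → IsZeroR-sumR (suc v₂) λ _ → IsZeroR-0R
  IsZeroR-sumR³-*R {suc _} {suc _} {suc _} {suc _} {suc _} {suc _} f g z =
    IsZeroR-⊑ (sumR³-*R f g) (IsZeroR-*R z)

module KroneckerDegeneration {c ℓ : Level} (𝔽 : Field c ℓ) where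
  open Degen 𝔽
  open Field 𝔽 using (_*_)
  open Polynomial 𝔽
  open RationalFunction 𝔽
  open FiniteSum 𝔽
  open NaturalCoefficients +P-*P-commutativeSemiring using (solve; _:=_; _:*_)

  summand : ∀ {u v w p q r} → Mat p u → Mat q v → Mat r w → Tensor u v w →
    Fin p → Fin q → Fin r → Fin u → Fin v → Fin w → RatFn
  summand A B C S i j k x y z = ((A i x *R B j y) *R C k z) *R constR (S x y z)

  *R-constR-interchange : ∀ a₁ a₂ b₁ b₂ c₁ c₂ s₁ s₂ →
    ((((a₁ *R a₂) *R (b₁ *R b₂)) *R (c₁ *R c₂)) *R constR (s₁ * s₂))
      ≃ ((((a₁ *R b₁) *R c₁) *R constR s₁) *R (((a₂ *R b₂) *R c₂) *R constR s₂))
  *R-constR-interchange a₁ a₂ b₁ b₂ c₁ c₂ s₁ s₂ = mk≃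
    (≋-trans (*P-congˡ (((num a₁ *P num a₂) *P (num b₁ *P num b₂)) *P (num c₁ *P num c₂))
                       (constP-* s₁ s₂))
             (rearrange (num a₁) (num a₂) (num b₁) (num b₂) (num c₁) (num c₂) (constP s₁) (constP s₂)))
    (≋-trans (*P-congˡ (((den a₁ *P den a₂) *P (den b₁ *P den b₂)) *P (den c₁ *P den c₂))
                       (≋-sym (*P-identityˡ 1P)))
             (rearrange (den a₁) (den a₂) (den b₁) (den b₂) (den c₁) (den c₂) 1P 1P))
    where
    rearrange : ∀ a₁ a₂ b₁ b₂ c₁ c₂ s₁ s₂ →
      ((((a₁ *P a₂) *P (b₁ *P b₂)) *P (c₁ *P c₂)) *P (s₁ *P s₂))
        ≋ ((((a₁ *P b₁) *P c₁) *P s₁) *P (((a₂ *P b₂) *P c₂) *P s₂))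
    rearrange = solve 8 (λ a₁ a₂ b₁ b₂ c₁ c₂ s₁ s₂ →
                   (((a₁ :* a₂) :* (b₁ :* b₂)) :* (c₁ :* c₂)) :* (s₁ :* s₂)
                := (((a₁ :* b₁) :* c₁) :* s₁) :* (((a₂ :* b₂) :* c₂) :* s₂)) ≋-refl

  module _ {u₁ v₁ w₁ u₂ v₂ w₂ p₁ q₁ r₁ p₂ q₂ r₂}
    (S₁ : Tensor u₁ v₁ w₁) (A₁ : Mat p₁ u₁) (B₁ : Mat q₁ v₁) (C₁ : Mat r₁ w₁)
    (S₂ : Tensor u₂ v₂ w₂) (A₂ : Mat p₂ u₂) (B₂ : Mat q₂ v₂) (C₂ : Mat r₂ w₂) where

    summand-⊗ : ∀ i j k x y z →
      let (i₁ , i₂) = split⊗ p₁ p₂ i ; (j₁ , j₂) = split⊗ q₁ q₂ j ; (k₁ , k₂) = split⊗ r₁ r₂ k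
          (x₁ , x₂) = split⊗ u₁ u₂ x ; (y₁ , y₂) = split⊗ v₁ v₂ y ; (z₁ , z₂) = split⊗ w₁ w₂ z
      in summand (A₁ ⊗M A₂) (B₁ ⊗M B₂) (C₁ ⊗M C₂) (S₁ ⊗T S₂) i j k x y z
           ≃ (summand A₁ B₁ C₁ S₁ i₁ j₁ k₁ x₁ y₁ z₁ *R summand A₂ B₂ C₂ S₂ i₂ j₂ k₂ x₂ y₂ z₂)
    summand-⊗ i j k x y z =
      let (i₁ , i₂) = split⊗ p₁ p₂ i ; (j₁ , j₂) = split⊗ q₁ q₂ j ; (k₁ , k₂) = split⊗ r₁ r₂ k
          (x₁ , x₂) = split⊗ u₁ u₂ x ; (y₁ , y₂) = split⊗ v₁ v₂ y ; (z₁ , z₂) = split⊗ w₁ w₂ z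
      in *R-constR-interchange (A₁ i₁ x₁) (A₂ i₂ x₂) (B₁ j₁ y₁) (B₂ j₂ y₂) (C₁ k₁ z₁) (C₂ k₂ z₂)
           (S₁ x₁ y₁ z₁) (S₂ x₂ y₂ z₂)

    apply-⊗ : ∀ i j k →
      let (i₁ , i₂) = split⊗ p₁ p₂ i ; (j₁ , j₂) = split⊗ q₁ q₂ j ; (k₁ , k₂) = split⊗ r₁ r₂ k
      in apply (A₁ ⊗M A₂) (B₁ ⊗M B₂) (C₁ ⊗M C₂) (S₁ ⊗T S₂) i j k
           ⊑ sumR³ u₁ v₁ w₁ (λ x₁ y₁ z₁ → sumR³ u₂ v₂ w₂ λ x₂ y₂ z₂ →
               summand A₁ B₁ C₁ S₁ i₁ j₁ k₁ x₁ y₁ z₁ *R summand A₂ B₂ C₂ S₂ i₂ j₂ k₂ x₂ y₂ z₂)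
    apply-⊗ i j k =
      let (i₁ , i₂) = split⊗ p₁ p₂ i ; (j₁ , j₂) = split⊗ q₁ q₂ j ; (k₁ , k₂) = split⊗ r₁ r₂ k
      in ⊑-trans
           (sumR³-cong (u₁ ℕ.* u₂) (v₁ ℕ.* v₂) (w₁ ℕ.* w₂) λ x y z → ≃⇒⊑ (summand-⊗ i j k x y z))
           (sumR³-remQuot u₁ v₁ w₁ u₂ v₂ w₂ λ (x₁ , x₂) (y₁ , y₂) (z₁ , z₂) →
             summand A₁ B₁ C₁ S₁ i₁ j₁ k₁ x₁ y₁ z₁ *R summand A₂ B₂ C₂ S₂ i₂ j₂ k₂ x₂ y₂ z₂)

  InSnd? : ∀ a₁ {a₂} (i : Fin (a₁ ℕ.+ a₂)) → Dec (InSnd a₁ i)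
  InSnd? a₁ i with F.splitAt a₁ i
  ... | inj₁ _ = no λ ()
  ... | inj₂ _ = yes tt

  isolated-factor : ∀ {u₁ v₁ w₁ u₂ v₂ w₂ a₁ b₁ c₁ a₁′ b₁′ c₁′ a₂ b₂ c₂ a₂′ b₂′ c₂′}
    (S₁ : Tensor u₁ v₁ w₁)
    (A₁ : Mat (a₁ ℕ.+ a₁′) u₁) (B₁ : Mat (b₁ ℕ.+ b₁′) v₁) (C₁ : Mat (c₁ ℕ.+ c₁′) w₁)
    (S₂ : Tensor u₂ v₂ w₂)
    (A₂ : Mat (a₂ ℕ.+ a₂′) u₂) (B₂ : Mat (b₂ ℕ.+ b₂′) v₂) (C₂ : Mat (c₂ ℕ.+ c₂′) w₂) →
    Isolated3 {a₁ = a₁} {b₁} {c₁} S₁ A₁ B₁ C₁ → Isolated3 {a₁ = a₂} {b₂} {c₂} S₂ A₂ B₂ C₂ →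
    ∀ i₁ j₁ k₁ i₂ j₂ k₂ → InSnd c₁ k₁ × InSnd c₂ k₂ →
    ¬ ((InSnd a₁ i₁ × InSnd a₂ i₂) × (InSnd b₁ j₁ × InSnd b₂ j₂)) →
    IsZeroR (apply A₁ B₁ C₁ S₁ i₁ j₁ k₁) ⊎ IsZeroR (apply A₂ B₂ C₂ S₂ i₂ j₂ k₂)
  isolated-factor {a₁ = a₁} {b₁} _ _ _ _ _ _ _ _ iso₁ iso₂ i₁ j₁ k₁ i₂ j₂ k₂ (k₁∈₂ , k₂∈₂) ¬i∈₂₂×j∈₂₂
    with InSnd? a₁ i₁ | InSnd? b₁ j₁
  ... | no i₁∉₂  | _         = inj₁ (mkIsZeroR (mk≋ (iso₁ i₁ j₁ k₁ k₁∈₂ (i₁∉₂ ∘ proj₁))))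
  ... | yes _    | no j₁∉₂   = inj₁ (mkIsZeroR (mk≋ (iso₁ i₁ j₁ k₁ k₁∈₂ (j₁∉₂ ∘ proj₂))))
  ... | yes i₁∈₂ | yes j₁∈₂ = inj₂ (mkIsZeroR (mk≋ (iso₂ i₂ j₂ k₂ k₂∈₂
    λ (i₂∈₂ , j₂∈₂) → ¬i∈₂₂×j∈₂₂ ((i₁∈₂ , i₂∈₂) , (j₁∈₂ , j₂∈₂)))))

proposition5p4 : ∀ {c ℓ : Level} (𝔽 : Field c ℓ) →
    let open Degen 𝔽 in
    ∀ {u₁ v₁ w₁ u₂ v₂ w₂ : ℕ}
      {a₁ b₁ c₁ a₁' b₁' c₁' a₂ b₂ c₂ a₂' b₂' c₂' : ℕ}
      (S₁ : Tensor u₁ v₁ w₁) (T₁ : Tensor a₁ b₁ c₁) (T₁' : Tensor a₁' b₁' c₁')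
      (S₂ : Tensor u₂ v₂ w₂) (T₂ : Tensor a₂ b₂ c₂) (T₂' : Tensor a₂' b₂' c₂')
      (A₁ : Mat (a₁ + a₁') u₁) (B₁ : Mat (b₁ + b₁') v₁) (C₁ : Mat (c₁ + c₁') w₁)
      (A₂ : Mat (a₂ + a₂') u₂) (B₂ : Mat (b₂ + b₂') v₂) (C₂ : Mat (c₂ + c₂') w₂) →
    Degeneration S₁ T₁ T₁' A₁ B₁ C₁ →
    Degeneration S₂ T₂ T₂' A₂ B₂ C₂ →
    Isolated3 {a₁ = a₁} {b₁} {c₁} S₁ A₁ B₁ C₁ →
    Isolated3 {a₁ = a₂} {b₂} {c₂} S₂ A₂ B₂ C₂ →
    Isolated3⊗ a₁ a₁' a₂ a₂' b₁ b₁' b₂ b₂' c₁ c₁' c₂ c₂'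
      (S₁ ⊗T S₂) (A₁ ⊗M A₂) (B₁ ⊗M B₂) (C₁ ⊗M C₂)
proposition5p4 𝔽 S₁ _ _ S₂ _ _ A₁ B₁ C₁ A₂ B₂ C₂ _ _ iso₁ iso₂ i j k k∈₂₂ ¬i∈₂₂×j∈₂₂ =
  coeff-≈ (IsZeroR.num≋[] (IsZeroR-⊑ (apply-⊗ S₁ A₁ B₁ C₁ S₂ A₂ B₂ C₂ i j k)
    (IsZeroR-sumR³-*R _ _ (isolated-factor S₁ A₁ B₁ C₁ S₂ A₂ B₂ C₂ iso₁ iso₂
      _ _ _ _ _ _ k∈₂₂ ¬i∈₂₂×j∈₂₂))))
  where
  open Polynomial 𝔽
  open RationalFunction 𝔽
  open FiniteSum 𝔽
  open KroneckerDegeneration 𝔽
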